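{- Fix integers $m\ge 2$ and $c\ge 1$. There exist constants $C,s_0>0$ depending only on $m,c$ such that for all integers $s\ge s_0$, with $n=ms+c$, every shifted family $\mathcal F\subset 2^{[n]}$ with $\nu(\mathcal F)<s$ and $d(\mathcal F)>(m-1)c$ satisfies \[ y_{\mathcal F}(m+1)\ge (2c-1)\binom{n}{m-1}-Cs^{m-2}. \]
   Context: $[n]=\{1,\dots,n\}$, $\ell=s-c$. $\nu(\mathcal G)$ is the maximum number of pairwise disjoint sets in $\mathcal G$. For $\mathcal F\subset 2^{[n]}$, $y_{\mathcal F}(i)=\binom{n}{i}-|\mathcal F\cap\binom{[n]}{i}|$. The deletion number is $d(\mathcal F)=\min\{|X|: X\subset[n],\ \nu(\mathcal F\cap\binom{[n]\setminus X}{m})<\ell\}$. Writing a set as $(a_1,\dots,a_k)$ with $a_1<\dots<a_k$, $(a_1,\dots,a_k)$ can be shifted to $(b_1,\dots,b_k)$ if $a_i\ge b_i$ for all $i$; a family is shifted if it is closed under this operation. (The paper writes the error term as $+O(s^{m-2})$ with $m,c$ fixed, $s\to\infty$.) -}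

module Defs where

open import Data.Nat using (ℕ; zero; suc; _≤_; _≡ᵇ_)
open import Data.Bool using (Bool; true; false; _∧_)
open import Data.Fin using (Fin; zero; suc)
import Data.Fin as Fin
open import Data.Fin.Subset using (Subset; ∣_∣; _∩_; ⊥)
open import Data.Vec using (Vec; []; _∷_)
open import Data.List using (List; []; _∷_; map; _++_; filter; length)
open import Data.List.Relation.Binary.Pointwise using (Pointwise)
open import Data.Product using (Σ; _×_)
open import Relation.Binary.PropositionalEquality using (_≡_; _≢_)
open import Relation.Nullary using (¬_)
open import Data.Nat.Combinatorics using (_C_)
open import Data.Nat using (_∸_)

Family : ℕ → Set
Family n = Subset n → Bool

_∈F_ : ∀ {n} → Subset n → Family n → Set
A ∈F F = F A ≡ true

-- Elements of a set listed in increasing order (a₁ < … < a_k).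
elems : ∀ {n} → Subset n → List (Fin n)
elems [] = []
elems (true ∷ p) = zero ∷ map suc (elems p)
elems (false ∷ p) = map suc (elems p)

ShiftsTo : ∀ {n} → Subset n → Subset n → Set
ShiftsTo A B = Pointwise (λ a b → b Fin.≤ a) (elems A) (elems B)

Shifted : ∀ {n} → Family n → Set
Shifted {n} F = (A B : Subset n) → A ∈F F → ShiftsTo A B → B ∈F F

Disjoint : ∀ {n} → Subset n → Subset n → Set
Disjoint A B = A ∩ B ≡ ⊥

HasMatching : ∀ {n} → (Subset n → Set) → ℕ → Set
HasMatching {n} G k =
  Σ (Fin k → Subset n) λ v →
    ((i : Fin k) → G (v i)) ×
    ((i j : Fin k) → i ≢ j → (v i ≢ v j) × Disjoint (v i) (v j))

νLess : ∀ {n} → (Subset n → Set) → ℕ → Set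
νLess G k = ¬ HasMatching G k

Restrict : ∀ {n} → Family n → ℕ → Subset n → Subset n → Set
Restrict F m X A = A ∈F F × ∣ A ∣ ≡ m × Disjoint A X

-- d(F) > k (with ℓ = s - c and uniformity m), i.e. no X with |X| ≤ k has
-- ν(F ∩ binom([n]∖X, m)) < ℓ.
DeletionGreater : ∀ {n} → Family n → (m ℓ k : ℕ) → Set
DeletionGreater {n} F m ℓ k =
  (X : Subset n) → ∣ X ∣ ≤ k → ¬ νLess (Restrict F m X) ℓ

allSubsets : (n : ℕ) → List (Subset n)
allSubsets zero = [] ∷ []
allSubsets (suc n) = map (true ∷_) (allSubsets n) ++ map (false ∷_) (allSubsets n)

levelCount : ∀ {n} → Family n → ℕ → ℕ
levelCount {n} F i = length (filter (λ A → Data.Bool.T? ((∣ A ∣ ≡ᵇ i) ∧ F A)) (allSubsets n))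
  where import Data.Bool

y : ∀ {n} → Family n → ℕ → ℕ
y {n} F i = (n C i) ∸ levelCount F i

-- Write n = p + 2c with p = (s - c) m + c (m - 1), and put the c pairwise disjoint pairs
-- Q_j = {j, 2c - 1 - j} in the last 2c coordinates. Call an (m - 1)-subset S of the first p
-- coordinates good if some S ∪ Q_j is missing from F. By shiftedness S ∪ P is then missing
-- for each of the 2c - 1 pairs P that shift to Q_j, so y_F(m + 1) ≥ (2c - 1) · #good.
-- The bad sets contain no c pairwise disjoint members T_j: otherwise d(F) > (m - 1) c gives
-- s - c disjoint m-sets of F avoiding ⋃ T_j, shifting moves them into the first p
-- coordinates, and together with the sets T_j ∪ Q_j they form s disjoint members of F.
-- So every bad set meets the union of a maximal disjoint family of bad sets, which has
-- fewer than c (m - 1) points, and #bad = O(p^(m-2)). Finally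
-- C(n, m - 1) - C(p, m - 1) = O(s^(m-2)).

module Submission where

open import Defs
open import Data.Nat using (ℕ; _≤_; _<_; _+_; _*_; _∸_; _^_)
open import Data.Nat.Combinatorics using (_C_)
open import Data.Product using (Σ; _×_)

open import Data.Bool using (true; false; T; _∧_)
import Data.Bool as Bool
open import Data.Bool.Properties using (T?; T-∧; ¬-not)
open import Data.Empty using (⊥-elim)
open import Data.Fin using (Fin; zero; suc; toℕ; splitAt; join; _↑ʳ_)
open import Data.Fin.Properties using (toℕ<n; toℕ-injective; join-splitAt)
import Data.Fin.Properties as Finₚ
open import Data.Fin.Subset using (Subset; inside; outside; ∣_∣; _∩_; _∪_; ⊥; ⊤; _∈_; _∉_; _⊆_; Nonempty)
open import Data.Fin.Subset.Properties
  using (∩-comm; ∩-zeroˡ; ∩-zeroʳ; ∣⊥∣≡0; Empty-unique; nonempty?; ∉⊥; ∈⊤; drop-there;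
         x∈p∩q⁺; x∈p∩q⁻; x∈p∪q⁻; p⊆p∪q; q⊆p∪q)
open import Data.List using (List; []; _∷_; _++_; map; length; filter; concatMap; applyUpTo)
open import Data.List.Properties
  using (map-++; map-∘; map-id; ++-assoc; length-map; length-++; length-++-sucʳ; length-applyUpTo; filter-++; filter-none)
open import Data.List.Membership.Propositional using (find; lose) renaming (_∈_ to _∈ₗ_)
open import Data.List.Membership.Propositional.Properties
  renaming (∈-map⁺ to ∈ₗ-map⁺; ∈-map⁻ to ∈ₗ-map⁻; ∈-++⁺ˡ to ∈ₗ-++⁺ˡ; ∈-++⁺ʳ to ∈ₗ-++⁺ʳ; ∈-++⁻ to ∈ₗ-++⁻;
            ∈-∃++ to ∈ₗ-∃++; ∈-filter⁺ to ∈ₗ-filter⁺; ∈-filter⁻ to ∈ₗ-filter⁻; ∈-applyUpTo⁻ to ∈ₗ-applyUpTo⁻;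
            ∈-concatMap⁺ to ∈ₗ-concatMap⁺; ∈-concatMap⁻ to ∈ₗ-concatMap⁻)
  using ()
open import Data.List.Relation.Binary.Pointwise using (Pointwise; []; _∷_)
import Data.List.Relation.Binary.Pointwise as Pointwise
open import Data.List.Relation.Unary.All using (All; []; _∷_)
import Data.List.Relation.Unary.All as All
import Data.List.Relation.Unary.All.Properties as All
open import Data.List.Relation.Unary.AllPairs using (AllPairs; []; _∷_)
import Data.List.Relation.Unary.AllPairs as AllPairs
import Data.List.Relation.Unary.AllPairs.Properties as AllPairs
open import Data.List.Relation.Unary.Any using (here; there)
import Data.List.Relation.Unary.Any as Any
open import Data.List.Relation.Unary.Unique.Propositional using (Unique)
import Data.List.Relation.Unary.Unique.Propositional.Properties as Unique
open import Data.Nat using (zero; suc; pred; z≤n; s≤s; s≤s⁻¹; _≡ᵇ_)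
open import Data.Nat.Combinatorics using (nCk+nC[k+1]≡[n+1]C[k+1])
open import Data.Nat.Properties
open import Data.Nat.Solver using (module +-*-Solver)
open import Data.Product using (_,_; proj₁; proj₂; ∃; ∃₂)
open import Data.Sum using (_⊎_; inj₁; inj₂; [_,_]′)
import Data.Sum as Sum
open import Data.Vec using ([]; _∷_; _[_]≔_; here; there) renaming (_++_ to _⊕_)
import Data.Vec as Vec
open import Data.Vec.Properties
  using (∷-injectiveʳ; ++-injectiveˡ; ++-injectiveʳ; zipWith-++; ≡-dec; []≔-idempotent; []≔-lookup; []=⇒lookup)
open import Data.Vec.Functional using () renaming (_∷_ to _∷ᶠ_; _++_ to _++ᶠ_)
open import Function using (_∘_; id; case_of_)
open import Function.Bundles using (Equivalence)
open import Relation.Binary.PropositionalEquality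
open import Relation.Nullary using (¬_; Dec; yes; no; does; ¬?)
import Relation.Unary as U

private variable
  n p q : ℕ

-- Positions and shifting

positions : Subset n → List ℕ
positions []            = []
positions (inside ∷ A)  = 0 ∷ map suc (positions A)
positions (outside ∷ A) = map suc (positions A)

_≽_ : List ℕ → List ℕ → Set
_≽_ = Pointwise (λ x y → y ≤ x)

Sorted : List ℕ → Set
Sorted = AllPairs _≤_

map-toℕ-map-suc : (xs : List (Fin n)) → map toℕ (map suc xs) ≡ map suc (map toℕ xs)
map-toℕ-map-suc xs = trans (sym (map-∘ xs)) (map-∘ xs)

map-toℕ-elems : (A : Subset n) → map toℕ (elems A) ≡ positions A
map-toℕ-elems []            = refl
map-toℕ-elems (inside ∷ A)  = cong (0 ∷_) (trans (map-toℕ-map-suc (elems A)) (cong (map suc) (map-toℕ-elems A)))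
map-toℕ-elems (outside ∷ A) = trans (map-toℕ-map-suc (elems A)) (cong (map suc) (map-toℕ-elems A))

shiftsTo-positions : (A B : Subset n) → positions A ≽ positions B → ShiftsTo A B
shiftsTo-positions A B h =
  Pointwise.map⁻ toℕ toℕ (subst₂ _≽_ (sym (map-toℕ-elems A)) (sym (map-toℕ-elems B)) h)

positions-sorted : (A : Subset n) → Sorted (positions A)
positions-sorted []            = []
positions-sorted (inside ∷ A)  = All.map⁺ (All.tabulate (λ _ → z≤n)) ∷ AllPairs.map⁺ (AllPairs.map s≤s (positions-sorted A))
positions-sorted (outside ∷ A) = AllPairs.map⁺ (AllPairs.map s≤s (positions-sorted A))

∣∣≡length-positions : (A : Subset n) → ∣ A ∣ ≡ length (positions A)
∣∣≡length-positions []            = refl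
∣∣≡length-positions (inside ∷ A)  = cong suc (trans (∣∣≡length-positions A) (sym (length-map suc (positions A))))
∣∣≡length-positions (outside ∷ A) = trans (∣∣≡length-positions A) (sym (length-map suc (positions A)))

map-suc-++-map-+ : ∀ xs ys → map suc (xs ++ map (p +_) ys) ≡ map suc xs ++ map (suc p +_) ys
map-suc-++-map-+ xs ys = trans (map-++ suc xs _) (cong (map suc xs ++_) (sym (map-∘ ys)))

positions-⊕ : (A : Subset p) (B : Subset q) → positions (A ⊕ B) ≡ positions A ++ map (p +_) (positions B)
positions-⊕ [] B = sym (map-id (positions B))
positions-⊕ (inside ∷ A) B =
  cong (0 ∷_) (trans (cong (map suc) (positions-⊕ A B)) (map-suc-++-map-+ (positions A) (positions B)))
positions-⊕ (outside ∷ A) B =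
  trans (cong (map suc) (positions-⊕ A B)) (map-suc-++-map-+ (positions A) (positions B))

sorted-++⁻ʳ : ∀ xs {ys} → Sorted (xs ++ ys) → Sorted ys
sorted-++⁻ʳ []       s       = s
sorted-++⁻ʳ (_ ∷ xs) (_ ∷ s) = sorted-++⁻ʳ xs s

≽-replace-by-lower-bound : ∀ f v z w → Sorted (v ++ z ∷ w) → All (f ≤_) (v ++ z ∷ w) →
  (v ++ z ∷ w) ≽ (f ∷ v ++ w)
≽-replace-by-lower-bound f []      z w _              (f≤z ∷ _) = f≤z ∷ Pointwise.refl ≤-refl
≽-replace-by-lower-bound f (x ∷ v) z w (x≤v++z∷w ∷ s) (f≤x ∷ _) = f≤x ∷ ≽-replace-by-lower-bound x v z w s x≤v++z∷w

positions-insert : (A : Subset n) (f : Fin n) → f ∉ A →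
  ∃₂ λ u w → positions A ≡ u ++ w × positions (A [ f ]≔ inside) ≡ u ++ toℕ f ∷ w × All (toℕ f <_) w
positions-insert (inside ∷ A)  zero    f∉A = ⊥-elim (f∉A here)
positions-insert (outside ∷ A) zero    _   = [] , map suc (positions A) , refl , refl , All.map⁺ (All.tabulate (λ _ → s≤s z≤n))
positions-insert (inside ∷ A)  (suc f) f∉A with positions-insert A f (f∉A ∘ there)
... | u , w , A≡ , A′≡ , f<w = 0 ∷ map suc u , map suc w ,
  cong (0 ∷_) (trans (cong (map suc) A≡) (map-++ suc u w)) ,
  cong (0 ∷_) (trans (cong (map suc) A′≡) (map-++ suc u _)) , All.map⁺ (All.map s≤s f<w)
positions-insert (outside ∷ A) (suc f) f∉A with positions-insert A f (f∉A ∘ there)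
... | u , w , A≡ , A′≡ , f<w = map suc u , map suc w ,
  trans (cong (map suc) A≡) (map-++ suc u w) ,
  trans (cong (map suc) A′≡) (map-++ suc u _) , All.map⁺ (All.map s≤s f<w)

positions-remove : (B : Subset n) (z : Fin n) → z ∈ B →
  ∃₂ λ v w → positions B ≡ v ++ toℕ z ∷ w × positions (B [ z ]≔ outside) ≡ v ++ w
positions-remove (inside ∷ B)  zero    here        = [] , map suc (positions B) , refl , refl
positions-remove (inside ∷ B)  (suc z) (there z∈B) with positions-remove B z z∈B
... | v , w , B≡ , B′≡ = 0 ∷ map suc v , map suc w ,
  cong (0 ∷_) (trans (cong (map suc) B≡) (map-++ suc v _)) ,
  cong (0 ∷_) (trans (cong (map suc) B′≡) (map-++ suc v w))
positions-remove (outside ∷ B) (suc z) (there z∈B) with positions-remove B z z∈B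
... | v , w , B≡ , B′≡ = map suc v , map suc w ,
  trans (cong (map suc) B≡) (map-++ suc v _) ,
  trans (cong (map suc) B′≡) (map-++ suc v w)

shift-across : (A : Subset p) (B : Subset q) (f : Fin p) (z : Fin q) → f ∉ A → z ∈ B →
  ShiftsTo (A ⊕ B) ((A [ f ]≔ inside) ⊕ (B [ z ]≔ outside))
shift-across {p} A B f z f∉A z∈B with positions-insert A f f∉A | positions-remove B z z∈B
... | u , w , A≡ , A′≡ , f<w | v , w′ , B≡ , B′≡ =
  shiftsTo-positions (A ⊕ B) ((A [ f ]≔ inside) ⊕ (B [ z ]≔ outside)) (subst₂ _≽_ (sym before) (sym after)
    (Pointwise.++⁺ (Pointwise.refl ≤-refl)
      (≽-replace-by-lower-bound (toℕ f) M (p + toℕ z) R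
        (sorted-++⁻ʳ u (subst Sorted before (positions-sorted (A ⊕ B))))
        (subst (All (toℕ f ≤_)) tail≡ (All.++⁺ (All.map <⇒≤ f<w) (All.map⁺ (All.tabulate (λ _ → f≤p+))))))))
  where
  open ≡-Reasoning
  M = w ++ map (p +_) v
  R = map (p +_) w′
  f≤p+ : ∀ {x} → toℕ f ≤ p + x
  f≤p+ {x} = ≤-trans (<⇒≤ (toℕ<n f)) (m≤m+n p x)
  tail≡ : w ++ map (p +_) (v ++ toℕ z ∷ w′) ≡ M ++ (p + toℕ z) ∷ R
  tail≡ = trans (cong (w ++_) (map-++ (p +_) v _)) (sym (++-assoc w _ _))
  before : positions (A ⊕ B) ≡ u ++ (M ++ (p + toℕ z) ∷ R)
  before = begin
    positions (A ⊕ B)                                 ≡⟨ positions-⊕ A B ⟩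
    positions A ++ map (p +_) (positions B)           ≡⟨ cong₂ (λ a b → a ++ map (p +_) b) A≡ B≡ ⟩
    (u ++ w) ++ map (p +_) (v ++ toℕ z ∷ w′)          ≡⟨ ++-assoc u w _ ⟩
    u ++ (w ++ map (p +_) (v ++ toℕ z ∷ w′))          ≡⟨ cong (u ++_) tail≡ ⟩
    u ++ (M ++ (p + toℕ z) ∷ R)                       ∎
  after : positions ((A [ f ]≔ inside) ⊕ (B [ z ]≔ outside)) ≡ u ++ (toℕ f ∷ M ++ R)
  after = begin
    positions ((A [ f ]≔ inside) ⊕ (B [ z ]≔ outside))
      ≡⟨ positions-⊕ (A [ f ]≔ inside) (B [ z ]≔ outside) ⟩
    positions (A [ f ]≔ inside) ++ map (p +_) (positions (B [ z ]≔ outside))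
      ≡⟨ cong₂ (λ a b → a ++ map (p +_) b) A′≡ B′≡ ⟩
    (u ++ toℕ f ∷ w) ++ map (p +_) (v ++ w′)
      ≡⟨ ++-assoc u _ _ ⟩
    u ++ (toℕ f ∷ w ++ map (p +_) (v ++ w′))
      ≡⟨ cong (λ t → u ++ (toℕ f ∷ w ++ t)) (map-++ (p +_) v w′) ⟩
    u ++ (toℕ f ∷ w ++ (map (p +_) v ++ R))
      ≡⟨ cong (λ t → u ++ (toℕ f ∷ t)) (sym (++-assoc w _ _)) ⟩
    u ++ (toℕ f ∷ M ++ R)
      ∎

positions-⊥ : positions (⊥ {n}) ≡ []
positions-⊥ {zero}  = refl
positions-⊥ {suc n} = cong (map suc) (positions-⊥ {n})

point : ℕ → (q : ℕ) → Subset q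
point _       zero    = []
point zero    (suc q) = inside ∷ ⊥
point (suc x) (suc q) = outside ∷ point x q

-- The pair {x, y} ⊆ [q]; junk unless x < y < q.
pair : ℕ → ℕ → (q : ℕ) → Subset q
pair _       _ zero    = []
pair zero    y (suc q) = inside ∷ point (pred y) q
pair (suc x) y (suc q) = outside ∷ pair x (pred y) q

positions-point : ∀ {x} → x < q → positions (point x q) ≡ x ∷ []
positions-point {suc q} {zero}  _         = cong (0 ∷_) (cong (map suc) (positions-⊥ {q}))
positions-point {suc q} {suc x} (s≤s x<q) = cong (map suc) (positions-point x<q)

positions-pair : ∀ {x y} → x < y → y < q → positions (pair x y q) ≡ x ∷ y ∷ []
positions-pair {suc q} {zero}  {suc y} _         (s≤s y<q) = cong (0 ∷_) (cong (map suc) (positions-point y<q))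
positions-pair {suc q} {suc x} {suc y} (s≤s x<y) (s≤s y<q) = cong (map suc) (positions-pair x<y y<q)

∣pair∣≡2 : ∀ {x y} → x < y → y < q → ∣ pair x y q ∣ ≡ 2
∣pair∣≡2 {q} {x} {y} x<y y<q = trans (∣∣≡length-positions (pair x y q)) (cong length (positions-pair x<y y<q))

pair-injective : ∀ {x y x′ y′} → x < y → y < q → x′ < y′ → y′ < q → pair x y q ≡ pair x′ y′ q → x ≡ x′ × y ≡ y′
pair-injective x<y y<q x′<y′ y′<q e with trans (sym (positions-pair x<y y<q)) (trans (cong positions e) (positions-pair x′<y′ y′<q))
... | refl = refl , refl

pair-shift : (F : Family (p + q)) → Shifted F → (S : Subset p) → ∀ {x y x′ y′} →
  x′ < y′ → x < y → y < q → x′ ≤ x → y′ ≤ y → (S ⊕ pair x y q) ∈F F → (S ⊕ pair x′ y′ q) ∈F F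
pair-shift {p} {q} F shifted S {x} {y} {x′} {y′} x′<y′ x<y y<q x′≤x y′≤y S⊕xy∈F =
  shifted _ _ S⊕xy∈F (shiftsTo-positions (S ⊕ pair x y q) (S ⊕ pair x′ y′ q)
    (subst₂ _≽_ (sym (positions-S⊕ x<y y<q)) (sym (positions-S⊕ x′<y′ (≤-<-trans y′≤y y<q)))
      (Pointwise.++⁺ (Pointwise.refl ≤-refl) (+-monoʳ-≤ p x′≤x ∷ +-monoʳ-≤ p y′≤y ∷ []))))
  where
  positions-S⊕ : ∀ {x y} → x < y → y < q → positions (S ⊕ pair x y q) ≡ positions S ++ (p + x) ∷ (p + y) ∷ []
  positions-S⊕ x<y y<q = trans (positions-⊕ S _) (cong (λ t → positions S ++ map (p +_) t) (positions-pair x<y y<q))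

∉F-by-contraposition : {F : Family n} {A B : Subset n} → (A ∈F F → B ∈F F) → F B ≡ false → F A ≡ false
∉F-by-contraposition A∈F→B∈F FB≡false = ¬-not λ A∈F → case trans (sym (A∈F→B∈F A∈F)) FB≡false of λ ()

-- Disjointness and sizes

disjoint⁺ : {A B : Subset n} → (∀ {x} → x ∈ A → x ∉ B) → Disjoint A B
disjoint⁺ {A = A} {B} h = Empty-unique λ (_ , x∈A∩B) → let (x∈A , x∈B) = x∈p∩q⁻ A B x∈A∩B in h x∈A x∈B

disjoint⁻ : {A B : Subset n} → Disjoint A B → ∀ {x} → x ∈ A → x ∉ B
disjoint⁻ A∩B≡⊥ x∈A x∈B = ∉⊥ (subst (_ ∈_) A∩B≡⊥ (x∈p∩q⁺ (x∈A , x∈B)))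

disjoint-sym : {A B : Subset n} → Disjoint A B → Disjoint B A
disjoint-sym {A = A} {B} A∩B≡⊥ = trans (∩-comm B A) A∩B≡⊥

disjoint-mono : {A A′ B B′ : Subset n} → A′ ⊆ A → B′ ⊆ B → Disjoint A B → Disjoint A′ B′
disjoint-mono A′⊆A B′⊆B d = disjoint⁺ λ x∈A′ x∈B′ → disjoint⁻ d (A′⊆A x∈A′) (B′⊆B x∈B′)

disjoint? : (A B : Subset n) → Dec (Disjoint A B)
disjoint? A B = ≡-dec Bool._≟_ (A ∩ B) ⊥

¬disjoint⇒common : {A B : Subset n} → ¬ Disjoint A B → ∃ λ x → x ∈ A × x ∈ B
¬disjoint⇒common {A = A} {B} ¬d with nonempty? (A ∩ B)
... | yes (x , x∈A∩B) = x , x∈p∩q⁻ A B x∈A∩B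
... | no  A∩B-empty   = ⊥-elim (¬d (Empty-unique A∩B-empty))

disjoint⇒≢ : {A B : Subset n} → Disjoint A B → Nonempty A → A ≢ B
disjoint⇒≢ d (_ , x∈A) refl = disjoint⁻ d x∈A x∈A

disjoint-⊥ : (A : Subset n) → Disjoint A ⊥
disjoint-⊥ = ∩-zeroʳ

⊥-⊕ : ⊥ {p + q} ≡ ⊥ {p} ⊕ ⊥ {q}
⊥-⊕ {zero}  = refl
⊥-⊕ {suc p} = cong (outside ∷_) (⊥-⊕ {p})

disjoint-⊕⁺ : {A A′ : Subset p} {B B′ : Subset q} → Disjoint A A′ → Disjoint B B′ → Disjoint (A ⊕ B) (A′ ⊕ B′)
disjoint-⊕⁺ {p} {q} {A = A} {A′} {B} {B′} A∩A′≡⊥ B∩B′≡⊥ =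
  trans (zipWith-++ _∧_ A B A′ B′) (trans (cong₂ _⊕_ A∩A′≡⊥ B∩B′≡⊥) (sym (⊥-⊕ {p} {q})))

disjoint-⊕⁻ : {A A′ : Subset p} {B B′ : Subset q} → Disjoint (A ⊕ B) (A′ ⊕ B′) → Disjoint A A′ × Disjoint B B′
disjoint-⊕⁻ {p} {q} {A = A} {A′} {B} {B′} d = ++-injectiveˡ (A ∩ A′) ⊥ split , ++-injectiveʳ (A ∩ A′) ⊥ split
  where
  split : (A ∩ A′) ⊕ (B ∩ B′) ≡ ⊥ {p} ⊕ ⊥ {q}
  split = trans (sym (zipWith-++ _∧_ A B A′ B′)) (trans d (⊥-⊕ {p} {q}))

∈-[]≔inside⁻ : (A : Subset n) (f : Fin n) → ∀ {x} → x ∈ A [ f ]≔ inside → x ≡ f ⊎ x ∈ A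
∈-[]≔inside⁻ (a ∷ A) zero    here        = inj₁ refl
∈-[]≔inside⁻ (a ∷ A) zero    (there x∈A) = inj₂ (there x∈A)
∈-[]≔inside⁻ (a ∷ A) (suc f) here        = inj₂ here
∈-[]≔inside⁻ (a ∷ A) (suc f) (there x∈)  = Sum.map (cong suc) there (∈-[]≔inside⁻ A f x∈)

[]≔outside-⊆ : (B : Subset n) (z : Fin n) → B [ z ]≔ outside ⊆ B
[]≔outside-⊆ (b ∷ B) zero    (there x∈B) = there x∈B
[]≔outside-⊆ (b ∷ B) (suc z) here        = here
[]≔outside-⊆ (b ∷ B) (suc z) (there x∈)  = there ([]≔outside-⊆ B z x∈)

[]≔outside-[]≔inside : (B : Subset n) (z : Fin n) → z ∈ B → (B [ z ]≔ outside) [ z ]≔ inside ≡ B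
[]≔outside-[]≔inside B z z∈B = trans ([]≔-idempotent B z) (trans (cong (B [ z ]≔_) (sym ([]=⇒lookup z∈B))) ([]≔-lookup B z))

disjoint-[]≔inside : {A C : Subset n} {f : Fin n} → Disjoint A C → f ∉ C → Disjoint (A [ f ]≔ inside) C
disjoint-[]≔inside {A = A} {f = f} d f∉C = disjoint⁺ λ x∈ → [ (λ { refl → f∉C }) , disjoint⁻ d ]′ (∈-[]≔inside⁻ A f x∈)

∣[]≔inside∣ : (A : Subset n) (f : Fin n) → f ∉ A → ∣ A [ f ]≔ inside ∣ ≡ suc ∣ A ∣
∣[]≔inside∣ (inside ∷ A)  zero    f∉A = ⊥-elim (f∉A here)
∣[]≔inside∣ (outside ∷ A) zero    _   = refl
∣[]≔inside∣ (inside ∷ A)  (suc f) f∉A = cong suc (∣[]≔inside∣ A f (f∉A ∘ there))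
∣[]≔inside∣ (outside ∷ A) (suc f) f∉A = ∣[]≔inside∣ A f (f∉A ∘ there)

∣[]≔outside∣ : (B : Subset n) (z : Fin n) → z ∈ B → suc ∣ B [ z ]≔ outside ∣ ≡ ∣ B ∣
∣[]≔outside∣ (inside ∷ B)  zero    here        = refl
∣[]≔outside∣ (inside ∷ B)  (suc z) (there z∈B) = cong suc (∣[]≔outside∣ B z z∈B)
∣[]≔outside∣ (outside ∷ B) (suc z) (there z∈B) = ∣[]≔outside∣ B z z∈B

∣∣<n⇒∃∉ : (U : Subset n) → ∣ U ∣ < n → ∃ λ f → f ∉ U
∣∣<n⇒∃∉ (outside ∷ U) _       = zero , λ ()
∣∣<n⇒∃∉ (inside ∷ U)  (s≤s h) = let (f , f∉U) = ∣∣<n⇒∃∉ U h in suc f , λ { (there f∈U) → f∉U f∈U }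

∣∣≡suc⇒nonempty : ∀ {t} (B : Subset n) → ∣ B ∣ ≡ suc t → Nonempty B
∣∣≡suc⇒nonempty (inside ∷ B)  _ = zero , here
∣∣≡suc⇒nonempty (outside ∷ B) h = let (z , z∈B) = ∣∣≡suc⇒nonempty B h in suc z , there z∈B

∣∪∣≤ : (A B : Subset n) → ∣ A ∪ B ∣ ≤ ∣ A ∣ + ∣ B ∣
∣∪∣≤ []            []            = z≤n
∣∪∣≤ (outside ∷ A) (outside ∷ B) = ∣∪∣≤ A B
∣∪∣≤ (inside ∷ A)  (outside ∷ B) = s≤s (∣∪∣≤ A B)
∣∪∣≤ (outside ∷ A) (inside ∷ B)  = ≤-trans (s≤s (∣∪∣≤ A B)) (≤-reflexive (sym (+-suc ∣ A ∣ ∣ B ∣)))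
∣∪∣≤ (inside ∷ A)  (inside ∷ B)  = s≤s (≤-trans (∣∪∣≤ A B) (+-monoʳ-≤ ∣ A ∣ (n≤1+n ∣ B ∣)))

∣∣≡0⇒≡⊥ : (B : Subset n) → ∣ B ∣ ≡ 0 → B ≡ ⊥
∣∣≡0⇒≡⊥ []            _ = refl
∣∣≡0⇒≡⊥ (outside ∷ B) h = cong (outside ∷_) (∣∣≡0⇒≡⊥ B h)

∣⊕∣ : (A : Subset p) (B : Subset q) → ∣ A ⊕ B ∣ ≡ ∣ A ∣ + ∣ B ∣
∣⊕∣ []            B = refl
∣⊕∣ (inside ∷ A)  B = cong suc (∣⊕∣ A B)
∣⊕∣ (outside ∷ A) B = ∣⊕∣ A B

∣⊕⊥∣ : (A : Subset p) → ∣ A ⊕ ⊥ {q} ∣ ≡ ∣ A ∣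
∣⊕⊥∣ {q = q} A = trans (∣⊕∣ A ⊥) (trans (cong (∣ A ∣ +_) (∣⊥∣≡0 q)) (+-identityʳ ∣ A ∣))

⊕-mono-⊆ : {A A′ : Subset p} {B B′ : Subset q} → A ⊆ A′ → B ⊆ B′ → A ⊕ B ⊆ A′ ⊕ B′
⊕-mono-⊆ {A = []}    {[]}     _    B⊆B′ x∈         = B⊆B′ x∈
⊕-mono-⊆ {A = a ∷ A} {a′ ∷ A′} A⊆A′ _    here        with A⊆A′ here
... | here = here
⊕-mono-⊆ {A = a ∷ A} {a′ ∷ A′} A⊆A′ B⊆B′ (there x∈) = there (⊕-mono-⊆ (λ y∈A → drop-there (A⊆A′ (there y∈A))) B⊆B′ x∈)

∈-⊕ʳ : (A : Subset p) {B : Subset q} {x : Fin q} → x ∈ B → (p ↑ʳ x) ∈ A ⊕ B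
∈-⊕ʳ []      x∈B = x∈B
∈-⊕ʳ (a ∷ A) x∈B = there (∈-⊕ʳ A x∈B)

PairwiseDisjoint : ∀ {r} → (Fin r → Subset n) → Set
PairwiseDisjoint T = ∀ i j → i ≢ j → Disjoint (T i) (T j)

⋃ᶠ : ∀ {r} → (Fin r → Subset n) → Subset n
⋃ᶠ {r = zero}  _ = ⊥
⋃ᶠ {r = suc r} T = T zero ∪ ⋃ᶠ (T ∘ suc)

⊆-⋃ᶠ : ∀ {r} (T : Fin r → Subset n) i → T i ⊆ ⋃ᶠ T
⊆-⋃ᶠ T zero    = p⊆p∪q _
⊆-⋃ᶠ T (suc i) = q⊆p∪q (T zero) _ ∘ ⊆-⋃ᶠ (T ∘ suc) i

∣⋃ᶠ∣≤ : ∀ {r b} (T : Fin r → Subset n) → (∀ i → ∣ T i ∣ ≤ b) → ∣ ⋃ᶠ T ∣ ≤ r * b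
∣⋃ᶠ∣≤ {n} {r = zero}  T _ = ≤-reflexive (∣⊥∣≡0 n)
∣⋃ᶠ∣≤ {r = suc r} T h = ≤-trans (∣∪∣≤ (T zero) _) (+-mono-≤ (h zero) (∣⋃ᶠ∣≤ (T ∘ suc) (h ∘ suc)))

disjoint-∪ : {A U W : Subset n} → Disjoint A U → Disjoint A W → Disjoint A (U ∪ W)
disjoint-∪ {U = U} {W} d₁ d₂ = disjoint⁺ λ x∈A x∈U∪W → [ disjoint⁻ d₁ x∈A , disjoint⁻ d₂ x∈A ]′ (x∈p∪q⁻ U W x∈U∪W)

disjoint-⋃ᶠ : ∀ {r} {A : Subset n} (T : Fin r → Subset n) → (∀ i → Disjoint A (T i)) → Disjoint A (⋃ᶠ T)
disjoint-⋃ᶠ {r = zero}  {A} T _ = disjoint-⊥ A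
disjoint-⋃ᶠ {r = suc r}     T d = disjoint-∪ (d zero) (disjoint-⋃ᶠ (T ∘ suc) (d ∘ suc))

pairwiseDisjoint-∷ : ∀ {r} {S : Subset n} {T : Fin r → Subset n} →
  Disjoint S (⋃ᶠ T) → PairwiseDisjoint T → PairwiseDisjoint (S ∷ᶠ T)
pairwiseDisjoint-∷ S#⋃T T-pairwise zero    zero    0≢0 = ⊥-elim (0≢0 refl)
pairwiseDisjoint-∷ S#⋃T T-pairwise zero    (suc j) _   = disjoint-mono id (⊆-⋃ᶠ _ j) S#⋃T
pairwiseDisjoint-∷ S#⋃T T-pairwise (suc i) zero    _   = disjoint-sym (disjoint-mono id (⊆-⋃ᶠ _ i) S#⋃T)
pairwiseDisjoint-∷ S#⋃T T-pairwise (suc i) (suc j) i≢j = T-pairwise i j (i≢j ∘ cong suc)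

matching-∷ : ∀ {r m} {F : Family n} {Y Y′ V : Subset n} → Restrict F m Y V → Nonempty V → V ⊆ Y′ → Y ⊆ Y′ →
  HasMatching (Restrict F m Y′) r → HasMatching (Restrict F m Y) (suc r)
matching-∷ {r = r} {m} {F} {Y} {Y′} {V} V-restricted V-nonempty V⊆Y′ Y⊆Y′ (w , w-restricted , w-matching) =
  V ∷ᶠ w , restricted , matching
  where
  V#w : ∀ j → Disjoint V (w j)
  V#w j = disjoint-sym (disjoint-mono id V⊆Y′ (proj₂ (proj₂ (w-restricted j))))
  restricted : ∀ i → Restrict F m Y ((V ∷ᶠ w) i)
  restricted zero    = V-restricted
  restricted (suc i) = let (w∈F , ∣w∣≡ , w#Y′) = w-restricted i in w∈F , ∣w∣≡ , disjoint-mono id Y⊆Y′ w#Y′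
  matching : ∀ i j → i ≢ j → ((V ∷ᶠ w) i ≢ (V ∷ᶠ w) j) × Disjoint ((V ∷ᶠ w) i) ((V ∷ᶠ w) j)
  matching zero    zero    0≢0 = ⊥-elim (0≢0 refl)
  matching zero    (suc j) _   = disjoint⇒≢ (V#w j) V-nonempty , V#w j
  matching (suc i) zero    _   = disjoint⇒≢ (V#w i) V-nonempty ∘ sym , disjoint-sym (V#w i)
  matching (suc i) (suc j) i≢j = w-matching i j (i≢j ∘ cong suc)

matching-++ : ∀ {r c m} {F : Family n} {Y : Subset n} → HasMatching (Restrict F m Y) r →
  (W : Fin c → Subset n) → (∀ j → W j ∈F F) → (∀ j → Nonempty (W j)) → PairwiseDisjoint W → (∀ j → W j ⊆ Y) →
  HasMatching (_∈F F) (r + c)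
matching-++ {r = r} {c} {F = F} (v , v-restricted , v-matching) W W∈F W-nonempty W-pairwise W⊆Y =
  v ++ᶠ W , (λ i → ∈F (splitAt r i)) , λ i j i≢j → matching (splitAt r i) (splitAt r j) (i≢j ∘ splitAt-injective)
  where
  splitAt-injective : ∀ {i j} → splitAt r i ≡ splitAt r j → i ≡ j
  splitAt-injective {i} {j} e = trans (sym (join-splitAt r c i)) (trans (cong (join r c) e) (join-splitAt r c j))
  ∈F : ∀ a → [ v , W ]′ a ∈F F
  ∈F (inj₁ i) = proj₁ (v-restricted i)
  ∈F (inj₂ j) = W∈F j
  cross : ∀ i j → (v i ≢ W j) × Disjoint (v i) (W j)
  cross i j = let d = disjoint-mono id (W⊆Y j) (proj₂ (proj₂ (v-restricted i))) in disjoint⇒≢ (disjoint-sym d) (W-nonempty j) ∘ sym , d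
  matching : ∀ a b → a ≢ b → ([ v , W ]′ a ≢ [ v , W ]′ b) × Disjoint ([ v , W ]′ a) ([ v , W ]′ b)
  matching (inj₁ i) (inj₁ j) i≢j = v-matching i j (i≢j ∘ cong inj₁)
  matching (inj₁ i) (inj₂ j) _   = cross i j
  matching (inj₂ j) (inj₁ i) _   = let (ne , d) = cross i j in ne ∘ sym , disjoint-sym d
  matching (inj₂ i) (inj₂ j) i≢j = let d = W-pairwise i j (i≢j ∘ cong inj₂) in disjoint⇒≢ d (W-nonempty i) , d

-- Pushing a matching into the first block

relocate : (F : Family (p + q)) → Shifted F → (U A : Subset p) (B : Subset q) →
  ∣ U ∣ + (∣ A ∣ + ∣ B ∣) ≤ p → Disjoint A U → (A ⊕ B) ∈F F →
  ∃ λ A′ → (A′ ⊕ ⊥) ∈F F × ∣ A′ ∣ ≡ ∣ A ∣ + ∣ B ∣ × Disjoint A′ U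
relocate {p} F shifted U A B = go ∣ B ∣ A B refl
  where
  go : ∀ t A B → ∣ B ∣ ≡ t → ∣ U ∣ + (∣ A ∣ + ∣ B ∣) ≤ p → Disjoint A U → (A ⊕ B) ∈F F →
    ∃ λ A′ → (A′ ⊕ ⊥) ∈F F × ∣ A′ ∣ ≡ ∣ A ∣ + ∣ B ∣ × Disjoint A′ U
  go zero A B ∣B∣≡0 _ A#U A⊕B∈F =
    A , subst (λ B → (A ⊕ B) ∈F F) (∣∣≡0⇒≡⊥ B ∣B∣≡0) A⊕B∈F ,
    sym (trans (cong (∣ A ∣ +_) ∣B∣≡0) (+-identityʳ ∣ A ∣)) , A#U
  go (suc t) A B ∣B∣≡1+t room A#U A⊕B∈F =
    let A′ , A′⊕⊥∈F , ∣A′∣≡ , A′#U = go t (A [ f ]≔ inside) (B [ z ]≔ outside)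
                                        (suc-injective (trans (∣[]≔outside∣ B z z∈B) ∣B∣≡1+t))
                                        (subst (λ s → ∣ U ∣ + s ≤ p) (sym size-kept) room)
                                        (disjoint-[]≔inside A#U f∉U)
                                        (shifted _ _ A⊕B∈F (shift-across A B f z f∉A z∈B))
    in A′ , A′⊕⊥∈F , trans ∣A′∣≡ size-kept , A′#U
    where
    0<∣B∣ : 0 < ∣ B ∣
    0<∣B∣ = subst (0 <_) (sym ∣B∣≡1+t) (s≤s z≤n)
    ∣U∪A∣<p : ∣ U ∪ A ∣ < p
    ∣U∪A∣<p = ≤-<-trans (∣∪∣≤ U A) (<-≤-trans (+-monoʳ-< ∣ U ∣ (m<m+n ∣ A ∣ 0<∣B∣)) room)
    z = proj₁ (∣∣≡suc⇒nonempty B ∣B∣≡1+t)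
    z∈B = proj₂ (∣∣≡suc⇒nonempty B ∣B∣≡1+t)
    f = proj₁ (∣∣<n⇒∃∉ (U ∪ A) ∣U∪A∣<p)
    f∉U : f ∉ U
    f∉U = proj₂ (∣∣<n⇒∃∉ (U ∪ A) ∣U∪A∣<p) ∘ p⊆p∪q A
    f∉A : f ∉ A
    f∉A = proj₂ (∣∣<n⇒∃∉ (U ∪ A) ∣U∪A∣<p) ∘ q⊆p∪q U A
    size-kept : ∣ A [ f ]≔ inside ∣ + ∣ B [ z ]≔ outside ∣ ≡ ∣ A ∣ + ∣ B ∣
    size-kept = trans (cong (_+ ∣ B [ z ]≔ outside ∣) (∣[]≔inside∣ A f f∉A))
                      (trans (sym (+-suc ∣ A ∣ ∣ B [ z ]≔ outside ∣)) (cong (∣ A ∣ +_) (∣[]≔outside∣ B z z∈B)))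

relocate-matching : (F : Family (p + q)) → Shifted F → ∀ {k} r (X : Subset p) → ∣ X ∣ + r * suc k ≤ p →
  (A : Fin r → Subset p) (B : Fin r → Subset q) → (∀ i → (A i ⊕ B i) ∈F F) → (∀ i → ∣ A i ∣ + ∣ B i ∣ ≡ suc k) →
  (∀ i → Disjoint (A i) X) → PairwiseDisjoint A → HasMatching (Restrict F (suc k) (X ⊕ ⊤)) r
relocate-matching F shifted zero X _ A B _ _ _ _ = (λ ()) , (λ ()) , λ ()
relocate-matching {p} {q} F shifted {k} (suc r) X room A B A⊕B∈F ∣A∣+∣B∣≡ A#X A-pairwise =
  let A₀ , A₀⊕⊥∈F , ∣A₀∣≡ , A₀#U = relocate F shifted U (A zero) (B zero) room₀ first#U (A⊕B∈F zero) in
  matching-∷ {F = F} (A₀⊕⊥∈F , ∣A₀⊕⊥∣≡ A₀ ∣A₀∣≡ , disjoint-⊕⁺ (disjoint-mono id (p⊆p∪q _) A₀#U) (∩-zeroˡ ⊤))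
             (∣∣≡suc⇒nonempty _ (∣A₀⊕⊥∣≡ A₀ ∣A₀∣≡))
             (⊕-mono-⊆ {B = ⊥} (q⊆p∪q X A₀) (λ _ → ∈⊤)) (⊕-mono-⊆ {A = X} {B = ⊤} (p⊆p∪q A₀) id)
             (relocate-matching F shifted r (X ∪ A₀) (room₁ A₀ ∣A₀∣≡) (A ∘ suc) (B ∘ suc) (A⊕B∈F ∘ suc) (∣A∣+∣B∣≡ ∘ suc)
                (λ i → disjoint-∪ (A#X (suc i)) (disjoint-sym (disjoint-mono id (q⊆p∪q X _ ∘ ⊆-⋃ᶠ (A ∘ suc) i) A₀#U)))
                (λ i j i≢j → A-pairwise (suc i) (suc j) (i≢j ∘ Finₚ.suc-injective)))
  where
  open ≤-Reasoning
  U = X ∪ ⋃ᶠ (A ∘ suc)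
  first#U : Disjoint (A zero) U
  first#U = disjoint-∪ (A#X zero) (disjoint-⋃ᶠ (A ∘ suc) (λ i → A-pairwise zero (suc i) λ ()))
  room₀ : ∣ U ∣ + (∣ A zero ∣ + ∣ B zero ∣) ≤ p
  room₀ = begin
    ∣ U ∣ + (∣ A zero ∣ + ∣ B zero ∣) ≤⟨ +-mono-≤ (≤-trans (∣∪∣≤ X _) (+-monoʳ-≤ ∣ X ∣ ∣⋃A∣≤)) (≤-reflexive (∣A∣+∣B∣≡ zero)) ⟩
    ∣ X ∣ + r * suc k + suc k        ≡⟨ trans (+-assoc ∣ X ∣ _ _) (cong (∣ X ∣ +_) (+-comm (r * suc k) _)) ⟩
    ∣ X ∣ + suc r * suc k            ≤⟨ room ⟩
    p                                ∎
    where
    ∣⋃A∣≤ : ∣ ⋃ᶠ (A ∘ suc) ∣ ≤ r * suc k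
    ∣⋃A∣≤ = ∣⋃ᶠ∣≤ (A ∘ suc) λ i → ≤-trans (m≤m+n _ _) (≤-reflexive (∣A∣+∣B∣≡ (suc i)))
  room₁ : (A₀ : Subset p) → ∣ A₀ ∣ ≡ ∣ A zero ∣ + ∣ B zero ∣ → ∣ X ∪ A₀ ∣ + r * suc k ≤ p
  room₁ A₀ ∣A₀∣≡ = begin
    ∣ X ∪ A₀ ∣ + r * suc k         ≤⟨ +-monoˡ-≤ (r * suc k) (≤-trans (∣∪∣≤ X A₀) (+-monoʳ-≤ ∣ X ∣ (≤-reflexive (trans ∣A₀∣≡ (∣A∣+∣B∣≡ zero))))) ⟩
    ∣ X ∣ + suc k + r * suc k      ≡⟨ +-assoc ∣ X ∣ (suc k) _ ⟩
    ∣ X ∣ + suc r * suc k          ≤⟨ room ⟩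
    p                              ∎
  ∣A₀⊕⊥∣≡ : (A₀ : Subset p) → ∣ A₀ ∣ ≡ ∣ A zero ∣ + ∣ B zero ∣ → ∣ A₀ ⊕ ⊥ {q} ∣ ≡ suc k
  ∣A₀⊕⊥∣≡ A₀ ∣A₀∣≡ = trans (∣⊕⊥∣ A₀) (trans ∣A₀∣≡ (∣A∣+∣B∣≡ zero))

no-disjoint-bad-sets : (F : Family (p + q)) → Shifted F → ∀ {k r c} → c * k + r * suc k ≤ p →
  νLess (_∈F F) (r + c) → DeletionGreater F (suc k) r (k * c) →
  (T : Fin c → Subset p) (Q : Fin c → Subset q) → (∀ j → ∣ T j ∣ ≤ k) → PairwiseDisjoint T →
  (∀ j → Nonempty (Q j)) → PairwiseDisjoint Q → ¬ (∀ j → (T j ⊕ Q j) ∈F F)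
no-disjoint-bad-sets {p} {q} F shifted {k} {r} {c} room ν<r+c d>kc T Q ∣T∣≤ T-pairwise Q-nonempty Q-pairwise T⊕Q∈F =
  d>kc (X ⊕ ⊥) ∣X⊕⊥∣≤ λ (v , v-restricted , v-matching) →
    ν<r+c (matching-++ {F = F} (relocated v v-restricted v-matching) (λ j → T j ⊕ Q j) T⊕Q∈F
             (λ j → let (x , x∈Q) = Q-nonempty j in p ↑ʳ x , ∈-⊕ʳ (T j) x∈Q)
             (λ i j i≢j → disjoint-⊕⁺ (T-pairwise i j i≢j) (Q-pairwise i j i≢j))
             (λ j → ⊕-mono-⊆ (⊆-⋃ᶠ T j) (λ _ → ∈⊤)))
  where
  X = ⋃ᶠ T
  ∣X∣≤ : ∣ X ∣ ≤ c * k
  ∣X∣≤ = ∣⋃ᶠ∣≤ T ∣T∣≤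
  ∣X⊕⊥∣≤ : ∣ X ⊕ ⊥ {q} ∣ ≤ k * c
  ∣X⊕⊥∣≤ = ≤-trans (≤-reflexive (∣⊕⊥∣ X)) (≤-trans ∣X∣≤ (≤-reflexive (*-comm c k)))
  relocated : (v : Fin r → Subset (p + q)) → (∀ i → Restrict F (suc k) (X ⊕ ⊥) (v i)) →
    (∀ i j → i ≢ j → (v i ≢ v j) × Disjoint (v i) (v j)) → HasMatching (Restrict F (suc k) (X ⊕ ⊤)) r
  relocated v v-restricted v-matching =
    relocate-matching F shifted r X (≤-trans (+-monoˡ-≤ (r * suc k) ∣X∣≤) room) A B
      (λ i → subst (_∈F F) (split i) (proj₁ (v-restricted i)))
      (λ i → trans (sym (∣⊕∣ (A i) (B i))) (trans (cong ∣_∣ (sym (split i))) (proj₁ (proj₂ (v-restricted i)))))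
      (λ i → proj₁ (disjoint-⊕⁻ (subst (λ V → Disjoint V (X ⊕ ⊥)) (split i) (proj₂ (proj₂ (v-restricted i))))))
      (λ i j i≢j → proj₁ (disjoint-⊕⁻ (subst₂ Disjoint (split i) (split j) (proj₂ (v-matching i j i≢j)))))
    where
    A : Fin r → Subset p
    A i = proj₁ (Vec.splitAt p (v i))
    B : Fin r → Subset q
    B i = proj₁ (proj₂ (Vec.splitAt p (v i)))
    split : ∀ i → v i ≡ A i ⊕ B i
    split i = proj₂ (proj₂ (Vec.splitAt p (v i)))

-- Counting subsets

∈-allSubsets : (A : Subset n) → A ∈ₗ allSubsets n
∈-allSubsets []                    = here refl
∈-allSubsets {suc n} (inside ∷ A)  = ∈ₗ-++⁺ˡ (∈ₗ-map⁺ (inside ∷_) (∈-allSubsets A))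
∈-allSubsets {suc n} (outside ∷ A) = ∈ₗ-++⁺ʳ (map (inside ∷_) (allSubsets n)) (∈ₗ-map⁺ (outside ∷_) (∈-allSubsets A))

allSubsets-unique : ∀ n → Unique (allSubsets n)
allSubsets-unique zero    = [] ∷ []
allSubsets-unique (suc n) = Unique.++⁺ (Unique.map⁺ ∷-injectiveʳ (allSubsets-unique n)) (Unique.map⁺ ∷-injectiveʳ (allSubsets-unique n))
  λ (∈inside , ∈outside) → case ∈ₗ-map⁻ (inside ∷_) ∈inside , ∈ₗ-map⁻ (outside ∷_) ∈outside of λ where
    ((_ , _ , refl) , (_ , _ , ())) 

level : (n k : ℕ) → List (Subset n)
level n k = filter (λ A → T? (∣ A ∣ ≡ᵇ k)) (allSubsets n)

length-filter-++ : ∀ {A : Set} {P : A → Set} (P? : U.Decidable P) xs ys →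
  length (filter P? (xs ++ ys)) ≡ length (filter P? xs) + length (filter P? ys)
length-filter-++ P? xs ys = trans (cong length (filter-++ P? xs ys)) (length-++ (filter P? xs))

length-filter-map : ∀ {A B : Set} {P : B → Set} (P? : U.Decidable P) (f : A → B) xs →
  length (filter P? (map f xs)) ≡ length (filter (P? ∘ f) xs)
length-filter-map P? f []       = refl
length-filter-map P? f (x ∷ xs) with does (P? (f x))
... | true  = cong suc (length-filter-map P? f xs)
... | false = length-filter-map P? f xs

length-level : ∀ n k → length (level n k) ≡ n C k
length-level zero    zero    = refl
length-level zero    (suc k) = refl
length-level (suc n) k = begin
  length (level (suc n) k)
    ≡⟨ length-filter-++ P? (map (inside ∷_) (allSubsets n)) _ ⟩
  length (filter P? (map (inside ∷_) (allSubsets n))) + length (filter P? (map (outside ∷_) (allSubsets n)))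
    ≡⟨ cong₂ _+_ (length-filter-map P? (inside ∷_) (allSubsets n)) (length-filter-map P? (outside ∷_) (allSubsets n)) ⟩
  length (filter (λ A → T? (suc ∣ A ∣ ≡ᵇ k)) (allSubsets n)) + length (level n k)
    ≡⟨ pascal k ⟩
  suc n C k ∎
  where
  open ≡-Reasoning
  P? = λ (A : Subset (suc n)) → T? (∣ A ∣ ≡ᵇ k)
  pascal : ∀ k → length (filter (λ A → T? (suc ∣ A ∣ ≡ᵇ k)) (allSubsets n)) + length (level n k) ≡ suc n C k
  pascal zero    = trans (cong (λ l → length l + length (level n 0))
                                (filter-none (λ A → T? (suc ∣ A ∣ ≡ᵇ 0)) {xs = allSubsets n} (All.tabulate λ _ ())))
                         (length-level n 0)
  pascal (suc k) = trans (cong₂ _+_ (length-level n k) (length-level n (suc k))) (nCk+nC[k+1]≡[n+1]C[k+1] n k)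

∈-level⁺ : {A : Subset n} {k : ℕ} → ∣ A ∣ ≡ k → A ∈ₗ level n k
∈-level⁺ {A = A} {k} ∣A∣≡k = ∈ₗ-filter⁺ (λ A → T? (∣ A ∣ ≡ᵇ k)) (∈-allSubsets A) (≡⇒≡ᵇ ∣ A ∣ k ∣A∣≡k)

∈-level⁻ : {A : Subset n} {k : ℕ} → A ∈ₗ level n k → ∣ A ∣ ≡ k
∈-level⁻ {n} {A} {k} A∈ = ≡ᵇ⇒≡ ∣ A ∣ k (proj₂ (∈ₗ-filter⁻ (λ A → T? (∣ A ∣ ≡ᵇ k)) {xs = allSubsets n} A∈))

level-unique : ∀ n k → Unique (level n k)
level-unique n k = Unique.filter⁺ _ (allSubsets-unique n)

length-≤-of-unique-⊆ : ∀ {A : Set} {xs ys : List A} → Unique xs → (∀ {x} → x ∈ₗ xs → x ∈ₗ ys) → length xs ≤ length ys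
length-≤-of-unique-⊆ {xs = []}     _                     _     = z≤n
length-≤-of-unique-⊆ {xs = x ∷ xs} (x∉xs ∷ xs-unique) xs⊆ys with ∈ₗ-∃++ (xs⊆ys (here refl))
... | ys₁ , ys₂ , refl =
  ≤-trans (s≤s (length-≤-of-unique-⊆ xs-unique λ y∈xs → drop-x (xs⊆ys (there y∈xs)) (All.lookup x∉xs y∈xs ∘ sym)))
          (≤-reflexive (sym (length-++-sucʳ ys₁ x ys₂)))
  where
  drop-x : ∀ {y} → y ∈ₗ ys₁ ++ x ∷ ys₂ → y ≢ x → y ∈ₗ ys₁ ++ ys₂
  drop-x y∈ y≢x with ∈ₗ-++⁻ ys₁ y∈
  ... | inj₁ y∈ys₁          = ∈ₗ-++⁺ˡ y∈ys₁
  ... | inj₂ (here y≡x)     = ⊥-elim (y≢x y≡x)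
  ... | inj₂ (there y∈ys₂)  = ∈ₗ-++⁺ʳ ys₁ y∈ys₂

length-filter-partition : ∀ {A : Set} {P : A → Set} (P? : U.Decidable P) xs →
  length (filter P? xs) + length (filter (¬? ∘ P?) xs) ≡ length xs
length-filter-partition P? []       = refl
length-filter-partition P? (x ∷ xs) with P? x
... | yes _ = cong suc (length-filter-partition P? xs)
... | no  _ = trans (+-suc _ _) (cong suc (length-filter-partition P? xs))

length-concatMap-≥ : ∀ {A B : Set} {P : A → Set} (P? : U.Decidable P) (h : A → List B) b xs →
  (∀ x → P x → b ≤ length (h x)) → b * length (filter P? xs) ≤ length (concatMap h xs)
length-concatMap-≥ P? h b []       _     = ≤-reflexive (*-zeroʳ b)
length-concatMap-≥ P? h b (x ∷ xs) long with P? x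
... | yes px = ≤-trans (≤-reflexive (*-suc b _))
                 (≤-trans (+-mono-≤ (long x px) (length-concatMap-≥ P? h b xs long)) (≤-reflexive (sym (length-++ (h x)))))
... | no  _  = ≤-trans (length-concatMap-≥ P? h b xs long) (≤-trans (m≤n+m _ (length (h x))) (≤-reflexive (sym (length-++ (h x)))))

length-concatMap-≤ : ∀ {A B : Set} (h : A → List B) b xs → (∀ x → length (h x) ≤ b) → length (concatMap h xs) ≤ length xs * b
length-concatMap-≤ h b []       _     = z≤n
length-concatMap-≤ h b (x ∷ xs) short = ≤-trans (≤-reflexive (length-++ (h x))) (+-mono-≤ (short x) (length-concatMap-≤ h b xs short))

concatMap-unique : ∀ {A B : Set} (h : A → List B) {xs} → Unique xs → (∀ x → Unique (h x)) →
  (∀ {x x′ y} → y ∈ₗ h x → y ∈ₗ h x′ → x ≡ x′) → Unique (concatMap h xs)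
concatMap-unique h xs-unique h-unique h-injective =
  Unique.concat⁺ (All.map⁺ (All.tabulate λ {x} _ → h-unique x))
                 (AllPairs.map⁺ (AllPairs.map (λ x≢x′ {_} (y∈hx , y∈hx′) → x≢x′ (h-injective y∈hx y∈hx′)) xs-unique))

length-≤-y : (F : Family n) (i : ℕ) {M : List (Subset n)} → Unique M →
  (∀ {A} → A ∈ₗ M → ∣ A ∣ ≡ i × F A ≡ false) → length M ≤ y F i
length-≤-y {n} F i {M} M-unique M-missing =
  m+n≤o⇒m≤o∸n (length M) (begin
    length M + length present ≡⟨ +-comm (length M) _ ⟩
    length present + length M ≡⟨ length-++ present ⟨
    length (present ++ M)     ≤⟨ length-≤-of-unique-⊆ (Unique.++⁺ (Unique.filter⁺ _ (allSubsets-unique n)) M-unique apart) ⊆level ⟩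
    length (level n i)        ≡⟨ length-level n i ⟩
    n C i                     ∎)
  where
  open ≤-Reasoning
  present? = λ (A : Subset n) → T? ((∣ A ∣ ≡ᵇ i) ∧ F A)
  present = filter present? (allSubsets n)
  present⁻ : ∀ {A} → A ∈ₗ present → T (∣ A ∣ ≡ᵇ i) × T (F A)
  present⁻ A∈ = Equivalence.to T-∧ (proj₂ (∈ₗ-filter⁻ present? {xs = allSubsets n} A∈))
  apart : ∀ {A} → ¬ (A ∈ₗ present × A ∈ₗ M)
  apart (A∈present , A∈M) = subst T (proj₂ (M-missing A∈M)) (proj₂ (present⁻ A∈present))
  ⊆level : ∀ {A} → A ∈ₗ present ++ M → A ∈ₗ level n i
  ⊆level {A} A∈ with ∈ₗ-++⁻ present A∈
  ... | inj₁ A∈present = ∈-level⁺ (≡ᵇ⇒≡ ∣ A ∣ i (proj₁ (present⁻ A∈present)))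
  ... | inj₂ A∈M       = ∈-level⁺ (proj₁ (M-missing A∈M))

∈⇒∈elems : {A : Subset n} {x : Fin n} → x ∈ A → x ∈ₗ elems A
∈⇒∈elems {A = inside ∷ A}  here        = here refl
∈⇒∈elems {A = inside ∷ A}  (there x∈A) = there (∈ₗ-map⁺ suc (∈⇒∈elems x∈A))
∈⇒∈elems {A = outside ∷ A} (there x∈A) = ∈ₗ-map⁺ suc (∈⇒∈elems x∈A)

length-elems : (A : Subset n) → length (elems A) ≡ ∣ A ∣
length-elems A = trans (sym (length-map toℕ (elems A))) (trans (cong length (map-toℕ-elems A)) (sym (∣∣≡length-positions A)))

∈⇒toℕ∈positions : {A : Subset n} {x : Fin n} → x ∈ A → toℕ x ∈ₗ positions A
∈⇒toℕ∈positions {A = A} x∈A = subst (_ ∈ₗ_) (map-toℕ-elems A) (∈ₗ-map⁺ toℕ (∈⇒∈elems x∈A))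

-- Greedy: if no member of L avoids the union U of the disjoint members found so far,
-- every member of L is an a-set plus one point of U.
disjoint-members-or-short : ∀ {p} a (L : List (Subset p)) → Unique L → (∀ {S} → S ∈ₗ L → ∣ S ∣ ≡ suc a) → ∀ r →
  (∃ λ (T : Fin r → Subset p) → (∀ i → T i ∈ₗ L) × PairwiseDisjoint T) ⊎ length L ≤ r * suc a * (p C a)
disjoint-members-or-short a L L-unique ∣L∣≡ zero = inj₁ ((λ ()) , (λ ()) , λ ())
disjoint-members-or-short {p} a L L-unique ∣L∣≡ (suc r) with disjoint-members-or-short a L L-unique ∣L∣≡ r
... | inj₂ short = inj₂ (≤-trans short (*-monoˡ-≤ (p C a) (*-monoˡ-≤ (suc a) (n≤1+n r))))
... | inj₁ (T , T∈L , T-pairwise) with Any.any? (λ S → disjoint? S (⋃ᶠ T)) L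
...   | yes ∃S = let (S , S∈L , S#⋃T) = find ∃S in
  inj₁ (S ∷ᶠ T , (λ { zero → S∈L ; (suc i) → T∈L i }) , pairwiseDisjoint-∷ S#⋃T T-pairwise)
...   | no ∄S = inj₂ (begin
  length L                          ≤⟨ length-≤-of-unique-⊆ L-unique (λ S∈L → ∈cover S∈L (∄S ∘ lose S∈L)) ⟩
  length (concatMap addTo (elems U)) ≤⟨ length-concatMap-≤ addTo (p C a) (elems U) (λ u → ≤-reflexive (trans (length-map _ (level p a)) (length-level p a))) ⟩
  length (elems U) * (p C a)        ≡⟨ cong (_* (p C a)) (length-elems U) ⟩
  ∣ U ∣ * (p C a)                   ≤⟨ *-monoˡ-≤ (p C a) (≤-trans (∣⋃ᶠ∣≤ T (λ i → ≤-reflexive (∣L∣≡ (T∈L i)))) (*-monoˡ-≤ (suc a) (n≤1+n r))) ⟩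
  suc r * suc a * (p C a)           ∎)
  where
  open ≤-Reasoning
  U = ⋃ᶠ T
  addTo : Fin p → List (Subset p)
  addTo u = map (_[ u ]≔ inside) (level p a)
  ∈cover : ∀ {S} → S ∈ₗ L → ¬ Disjoint S U → S ∈ₗ concatMap addTo (elems U)
  ∈cover {S} S∈L S∦U =
    let (u , u∈S , u∈U) = ¬disjoint⇒common S∦U in
    ∈ₗ-concatMap⁺ addTo (lose (∈⇒∈elems u∈U)
      (subst (_∈ₗ addTo u) ([]≔outside-[]≔inside S u u∈S)
        (∈ₗ-map⁺ (_[ u ]≔ inside) (∈-level⁺ (suc-injective (trans (∣[]≔outside∣ S u u∈S) (∣L∣≡ S∈L)))))))

-- Binomial estimates

C-suc-mono : ∀ n k → n C k ≤ suc n C k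
C-suc-mono n zero    = ≤-refl
C-suc-mono n (suc k) = ≤-trans (m≤n+m (n C suc k) (n C k)) (≤-reflexive (nCk+nC[k+1]≡[n+1]C[k+1] n k))

C-monoˡ : ∀ t n k → n C k ≤ (t + n) C k
C-monoˡ zero    n k = ≤-refl
C-monoˡ (suc t) n k = ≤-trans (C-monoˡ t n k) (C-suc-mono (t + n) k)

C-pascal-chain : ∀ t n k → (t + n) C suc k ≤ n C suc k + t * ((t + n) C k)
C-pascal-chain zero    n k = m≤m+n (n C suc k) 0
C-pascal-chain (suc t) n k = begin
  suc (t + n) C suc k                                   ≡⟨ nCk+nC[k+1]≡[n+1]C[k+1] (t + n) k ⟨
  (t + n) C k + (t + n) C suc k                         ≤⟨ +-mono-≤ (C-suc-mono (t + n) k) (C-pascal-chain t n k) ⟩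
  X + (n C suc k + t * ((t + n) C k))                   ≤⟨ +-monoʳ-≤ X (+-monoʳ-≤ (n C suc k) (*-monoʳ-≤ t (C-suc-mono (t + n) k))) ⟩
  X + (n C suc k + t * X)                               ≡⟨ +-assoc X (n C suc k) (t * X) ⟨
  X + n C suc k + t * X                                 ≡⟨ cong (_+ t * X) (+-comm X (n C suc k)) ⟩
  n C suc k + X + t * X                                 ≡⟨ +-assoc (n C suc k) X (t * X) ⟩
  n C suc k + suc t * X                                 ∎
  where
  open ≤-Reasoning
  X = suc (t + n) C k

C≤^ : ∀ n k → n C k ≤ n ^ k
C≤^ n       zero    = ≤-refl
C≤^ zero    (suc k) = z≤n
C≤^ (suc n) (suc k) = begin
  suc n C suc k          ≡⟨ nCk+nC[k+1]≡[n+1]C[k+1] n k ⟨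
  n C k + n C suc k      ≤⟨ +-mono-≤ (C≤^ n k) (C≤^ n (suc k)) ⟩
  n ^ k + n * n ^ k      ≤⟨ +-mono-≤ (^-monoˡ-≤ k (n≤1+n n)) (*-monoʳ-≤ n (^-monoˡ-≤ k (n≤1+n n))) ⟩
  suc n ^ suc k          ∎
  where open ≤-Reasoning

ms+c≤[m+c]s : ∀ m c {s} → 1 ≤ s → m * s + c ≤ (m + c) * s
ms+c≤[m+c]s m c {s} 1≤s = begin
  m * s + c       ≤⟨ +-monoʳ-≤ (m * s) (≤-trans (≤-reflexive (sym (*-identityʳ c))) (*-monoʳ-≤ c 1≤s)) ⟩
  m * s + c * s   ≡⟨ *-distribʳ-+ s m c ⟨
  (m + c) * s     ∎
  where open ≤-Reasoning

^-distribʳ-* : ∀ x y k → (x * y) ^ k ≡ x ^ k * y ^ k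
^-distribʳ-* x y zero    = refl
^-distribʳ-* x y (suc k) = trans (cong (x * y *_) (^-distribʳ-* x y k)) ([m*n]*[o*p]≡[m*o]*[n*p] x y (x ^ k) (y ^ k))

[ms+c]^k≤[m+c]^k*s^k : ∀ m c k {s} → 1 ≤ s → (m * s + c) ^ k ≤ (m + c) ^ k * s ^ k
[ms+c]^k≤[m+c]^k*s^k m c k 1≤s = ≤-trans (^-monoˡ-≤ k (ms+c≤[m+c]s m c 1≤s)) (≤-reflexive (^-distribʳ-* (m + c) _ k))

-- c = c′ + 1 and N = 2c - 1; the last 2c coordinates carry the pairs Q_j = special j.
module SpecialPairs (c′ : ℕ) where

  c N : ℕ
  c = suc c′
  N = c′ + c

  special : Fin c → Subset (suc N)
  special j = pair (toℕ j) (N ∸ toℕ j) (suc N)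

  dominating : ℕ → List (Subset (suc N))
  dominating j = applyUpTo (λ i → pair (j + i) N (suc N)) (N ∸ j) ++ applyUpTo (λ i → pair j (N ∸ j + i) (suc N)) j

  private
    j≤N : ∀ {j} → j ≤ c′ → j ≤ N
    j≤N j≤c′ = ≤-trans j≤c′ (m≤m+n c′ c)

    j<N∸j : ∀ {j} → j ≤ c′ → j < N ∸ j
    j<N∸j {j} j≤c′ = m+n≤o⇒m≤o∸n (suc j) (≤-trans (+-mono-≤ (s≤s j≤c′) j≤c′) (≤-reflexive (sym (+-suc c′ c′))))

    c≤N∸j : ∀ {j} → j ≤ c′ → c ≤ N ∸ j
    c≤N∸j j≤c′ = ≤-trans (≤-reflexive (sym (m+n∸m≡n c′ c))) (∸-monoʳ-≤ N j≤c′)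

    N∸j+j≡N : ∀ {j} → j ≤ c′ → N ∸ j + j ≡ N
    N∸j+j≡N j≤c′ = m∸n+n≡m (j≤N j≤c′)

    toℕ≤c′ : (j : Fin c) → toℕ j ≤ c′
    toℕ≤c′ j = s≤s⁻¹ (toℕ<n j)

    positions-special : (j : Fin c) → positions (special j) ≡ toℕ j ∷ N ∸ toℕ j ∷ []
    positions-special j = positions-pair (j<N∸j (toℕ≤c′ j)) (s≤s (m∸n≤m N (toℕ j)))

  special-nonempty : ∀ j → Nonempty (special j)
  special-nonempty j = ∣∣≡suc⇒nonempty (special j) (∣pair∣≡2 (j<N∸j (toℕ≤c′ j)) (s≤s (m∸n≤m N (toℕ j))))

  special-pairwiseDisjoint : PairwiseDisjoint special
  special-pairwiseDisjoint i j i≢j = disjoint⁺ λ x∈i x∈j →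
    clash (subst (_ ∈ₗ_) (positions-special i) (∈⇒toℕ∈positions x∈i))
          (subst (_ ∈ₗ_) (positions-special j) (∈⇒toℕ∈positions x∈j))
    where
    small≢large : ∀ (i j : Fin c) → toℕ i ≢ N ∸ toℕ j
    small≢large i j e = <⇒≱ (s≤s (toℕ≤c′ i)) (subst (c ≤_) (sym e) (c≤N∸j (toℕ≤c′ j)))
    clash : ∀ {v} → v ∈ₗ toℕ i ∷ N ∸ toℕ i ∷ [] → ¬ v ∈ₗ toℕ j ∷ N ∸ toℕ j ∷ []
    clash (here refl)         (here e)         = i≢j (toℕ-injective e)
    clash (here refl)         (there (here e)) = small≢large i j e
    clash (there (here refl)) (here e)         = small≢large j i (sym e)
    clash (there (here refl)) (there (here e)) =
      i≢j (toℕ-injective (∸-cancelˡ-≡ (j≤N (toℕ≤c′ i)) (j≤N (toℕ≤c′ j)) e))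

  length-dominating : ∀ {j} → j ≤ c′ → length (dominating j) ≡ N
  length-dominating {j} j≤c′ =
    trans (length-++ (applyUpTo (λ i → pair (j + i) N (suc N)) (N ∸ j)))
          (trans (cong₂ _+_ (length-applyUpTo _ (N ∸ j)) (length-applyUpTo _ j)) (N∸j+j≡N j≤c′))

  private
    j+i<N : ∀ {j i} → j ≤ c′ → i < N ∸ j → j + i < N
    j+i<N {j} j≤c′ i< = ≤-trans (+-monoʳ-< j i<) (≤-reflexive (m+[n∸m]≡n (j≤N j≤c′)))

    N∸j+i<N : ∀ {j i} → j ≤ c′ → i < j → N ∸ j + i < N
    N∸j+i<N {j} j≤c′ i<j = ≤-trans (+-monoʳ-< (N ∸ j) i<j) (≤-reflexive (N∸j+j≡N j≤c′))

    j<N∸j+i : ∀ {j} i → j ≤ c′ → j < N ∸ j + i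
    j<N∸j+i i j≤c′ = <-≤-trans (j<N∸j j≤c′) (m≤m+n _ i)

  ∈dominating⁻ : ∀ {j P} → j ≤ c′ → P ∈ₗ dominating j →
    ∃₂ λ x y → P ≡ pair x y (suc N) × x < y × y ≤ N × j ≤ x × N ∸ j ≤ y
  ∈dominating⁻ {j} j≤c′ P∈ with ∈ₗ-++⁻ (applyUpTo (λ i → pair (j + i) N (suc N)) (N ∸ j)) P∈
  ... | inj₁ P∈₁ with ∈ₗ-applyUpTo⁻ _ P∈₁
  ...   | i , i< , refl = j + i , N , refl , j+i<N j≤c′ i< , ≤-refl , m≤m+n j i , m∸n≤m N j
  ∈dominating⁻ {j} j≤c′ P∈ | inj₂ P∈₂ with ∈ₗ-applyUpTo⁻ _ P∈₂
  ...   | i , i<j , refl = j , N ∸ j + i , refl , j<N∸j+i i j≤c′ , <⇒≤ (N∸j+i<N j≤c′ i<j) , ≤-refl , m≤m+n _ i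

  dominating-unique : ∀ {j} → j ≤ c′ → Unique (dominating j)
  dominating-unique {j} j≤c′ = Unique.++⁺
    (Unique.applyUpTo⁺₁ _ (N ∸ j) λ i<i′ i′< e →
      <⇒≢ i<i′ (+-cancelˡ-≡ j _ _ (proj₁ (pair-injective (j+i<N j≤c′ (<-trans i<i′ i′<)) ≤-refl (j+i<N j≤c′ i′<) ≤-refl e))))
    (Unique.applyUpTo⁺₁ _ j λ {i} {i′} i<i′ i′<j e →
      <⇒≢ i<i′ (+-cancelˡ-≡ (N ∸ j) _ _ (proj₂ (pair-injective (j<N∸j+i i j≤c′) (≤-trans (N∸j+i<N j≤c′ (<-trans i<i′ i′<j)) (n≤1+n N))
                                                                (j<N∸j+i i′ j≤c′) (≤-trans (N∸j+i<N j≤c′ i′<j) (n≤1+n N)) e))))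
    apart
    where
    apart : ∀ {P} → ¬ (P ∈ₗ applyUpTo (λ i → pair (j + i) N (suc N)) (N ∸ j) × P ∈ₗ applyUpTo (λ i → pair j (N ∸ j + i) (suc N)) j)
    apart (P∈₁ , P∈₂) with ∈ₗ-applyUpTo⁻ _ P∈₁ | ∈ₗ-applyUpTo⁻ _ P∈₂
    ... | i , i< , refl | i′ , i′<j , e =
      <-irrefl (sym (proj₂ (pair-injective (j+i<N j≤c′ i<) ≤-refl (j<N∸j+i i′ j≤c′) (≤-trans (N∸j+i<N j≤c′ i′<j) (n≤1+n N)) e)))
               (N∸j+i<N j≤c′ i′<j)

  module _ {p} (F : Family (p + suc N)) (shifted : Shifted F) where

    missing : Subset p → List (Subset (suc N))
    missing S = filter (λ P → F (S ⊕ P) Bool.≟ false) (level (suc N) 2)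

    N≤length-missing : (S : Subset p) (j : Fin c) → F (S ⊕ special j) ≡ false → N ≤ length (missing S)
    N≤length-missing S j S⊕Qj∉F = begin
      N                                ≡⟨ length-dominating (toℕ≤c′ j) ⟨
      length (dominating (toℕ j))      ≤⟨ length-≤-of-unique-⊆ (dominating-unique (toℕ≤c′ j)) ⊆missing ⟩
      length (missing S)               ∎
      where
      open ≤-Reasoning
      ⊆missing : ∀ {P} → P ∈ₗ dominating (toℕ j) → P ∈ₗ missing S
      ⊆missing P∈ with ∈dominating⁻ (toℕ≤c′ j) P∈
      ... | x , y , refl , x<y , y≤N , j≤x , N∸j≤y =
        ∈ₗ-filter⁺ (λ P → F (S ⊕ P) Bool.≟ false) (∈-level⁺ (∣pair∣≡2 x<y (s≤s y≤N)))
          (∉F-by-contraposition {F = F} (pair-shift F shifted S (j<N∸j (toℕ≤c′ j)) x<y (s≤s y≤N) j≤x N∸j≤y) S⊕Qj∉F)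

    Good : Subset p → Set
    Good S = ∃ λ j → F (S ⊕ special j) ≡ false

    good? : U.Decidable Good
    good? S = Finₚ.any? (λ j → F (S ⊕ special j) Bool.≟ false)

    good bad : ℕ → List (Subset p)
    good k = filter good? (level p k)
    bad  k = filter (¬? ∘ good?) (level p k)

    ∈bad⁻ : ∀ {k S} → S ∈ₗ bad k → S ∈ₗ level p k × ¬ Good S
    ∈bad⁻ {k} = ∈ₗ-filter⁻ (¬? ∘ good?) {xs = level p k}

    good-bound : ∀ k → N * length (good k) ≤ y F (k + 2)
    good-bound k = ≤-trans
      (length-concatMap-≥ good? extensions N (level p k)
         (λ S (j , S⊕Qj∉F) → ≤-trans (N≤length-missing S j S⊕Qj∉F) (≤-reflexive (sym (length-map (S ⊕_) (missing S))))))
      (length-≤-y F (k + 2) all-missing-unique all-missing⁻)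
      where
      extensions : Subset p → List (Subset (p + suc N))
      extensions S = map (S ⊕_) (missing S)
      all-missing-unique : Unique (concatMap extensions (level p k))
      all-missing-unique = concatMap-unique extensions (level-unique p k)
        (λ S → Unique.map⁺ (++-injectiveʳ S S) (Unique.filter⁺ _ (level-unique (suc N) 2)))
        λ A∈S⊕ A∈S′⊕ → case ∈ₗ-map⁻ _ A∈S⊕ , ∈ₗ-map⁻ _ A∈S′⊕ of λ where
          ((_ , _ , refl) , (_ , _ , e)) → ++-injectiveˡ _ _ e
      all-missing⁻ : ∀ {A} → A ∈ₗ concatMap extensions (level p k) → ∣ A ∣ ≡ k + 2 × F A ≡ false
      all-missing⁻ A∈ with find (∈ₗ-concatMap⁻ extensions {xs = level p k} A∈)
      ... | S , S∈level , A∈S⊕ with ∈ₗ-map⁻ (S ⊕_) A∈S⊕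
      ... | P , P∈missing , refl =
        let (P∈level , S⊕P∉F) = ∈ₗ-filter⁻ (λ P → F (S ⊕ P) Bool.≟ false) {xs = level (suc N) 2} P∈missing in
        trans (∣⊕∣ S P) (cong₂ _+_ (∈-level⁻ S∈level) (∈-level⁻ P∈level)) , S⊕P∉F

    bad-bound : ∀ {a r} → c * suc a + r * suc (suc a) ≤ p → νLess (_∈F F) (r + c) →
      DeletionGreater F (suc (suc a)) r (suc a * c) → length (bad (suc a)) ≤ c * suc a * (p C a)
    bad-bound {a} room ν<r+c d>kc
      with disjoint-members-or-short a (bad (suc a)) (Unique.filter⁺ _ (level-unique p (suc a))) (∈-level⁻ ∘ proj₁ ∘ ∈bad⁻) c
    ... | inj₂ short = short
    ... | inj₁ (T , T∈bad , T-pairwise) =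
      ⊥-elim (no-disjoint-bad-sets F shifted room ν<r+c d>kc T special
                (λ j → ≤-reflexive (∈-level⁻ (proj₁ (∈bad⁻ (T∈bad j)))))
                T-pairwise special-nonempty special-pairwiseDisjoint
                (λ j → ¬-not λ T⊕Qj∉F → proj₂ (∈bad⁻ (T∈bad j)) (j , T⊕Qj∉F)))

    core-bound : ∀ {a r} → c * suc a + r * suc (suc a) ≤ p → νLess (_∈F F) (r + c) →
      DeletionGreater F (suc (suc a)) r (suc a * c) → N * (p C suc a) ≤ y F (suc a + 2) + N * (c * suc a * (p C a))
    core-bound {a} room ν<r+c d>kc = begin
      N * (p C suc a)                                   ≡⟨ cong (N *_) (trans (sym (length-level p (suc a))) (sym (length-filter-partition good? (level p (suc a))))) ⟩
      N * (length (good (suc a)) + length (bad (suc a))) ≡⟨ *-distribˡ-+ N (length (good (suc a))) _ ⟩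
      N * length (good (suc a)) + N * length (bad (suc a)) ≤⟨ +-mono-≤ (good-bound (suc a)) (*-monoʳ-≤ N (bad-bound room ν<r+c d>kc)) ⟩
      y F (suc a + 2) + N * (c * suc a * (p C a))       ∎
      where open ≤-Reasoning

  n≡p+2c : ∀ a r → suc (suc a) * (r + c) + c ≡ (r * suc (suc a) + c * suc a) + suc N
  n≡p+2c a r = solve 3 (λ r a c′ → (con 2 :+ a) :* (r :+ (con 1 :+ c′)) :+ (con 1 :+ c′)
                          := r :* (con 2 :+ a) :+ (con 1 :+ c′) :* (con 1 :+ a) :+ (con 1 :+ (c′ :+ (con 1 :+ c′))))
                       refl r a c′
    where open +-*-Solver

  estimate : ∀ {a r n} → n ≡ (r * suc (suc a) + c * suc a) + suc N → (F : Family n) → Shifted F →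
    νLess (_∈F F) (r + c) → DeletionGreater F (suc (suc a)) r (suc a * c) →
    N * (n C suc a) ≤ y F (suc a + 2) + N * (c * suc a + suc N) * n ^ a
  estimate {a} {r} refl F shifted ν<r+c d>kc = begin
    N * ((p₀ + suc N) C k)                                    ≡⟨ cong (λ t → N * (t C k)) (+-comm p₀ (suc N)) ⟩
    N * ((suc N + p₀) C k)                                    ≤⟨ *-monoʳ-≤ N (C-pascal-chain (suc N) p₀ a) ⟩
    N * (p₀ C k + suc N * B)                                  ≡⟨ *-distribˡ-+ N (p₀ C k) (suc N * B) ⟩
    N * (p₀ C k) + N * (suc N * B)                            ≤⟨ +-monoˡ-≤ _ (core-bound F shifted (≤-reflexive (+-comm (c * k) _)) ν<r+c d>kc) ⟩
    y F (k + 2) + N * (c * k * (p₀ C a)) + N * (suc N * B)    ≤⟨ +-monoˡ-≤ _ (+-monoʳ-≤ (y F (k + 2)) (*-monoʳ-≤ N (*-monoʳ-≤ (c * k) (C-monoˡ (suc N) p₀ a)))) ⟩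
    y F (k + 2) + N * (c * k * B) + N * (suc N * B)          ≡⟨ solve 5 (λ Y n x z b → Y :+ n :* (x :* b) :+ n :* (z :* b) := Y :+ n :* (x :+ z) :* b)
                                                                       refl (y F (k + 2)) N (c * k) (suc N) B ⟩
    y F (k + 2) + N * (c * k + suc N) * B                    ≤⟨ +-monoʳ-≤ (y F (k + 2)) (*-monoʳ-≤ (N * (c * k + suc N)) B≤n^a) ⟩
    y F (k + 2) + N * (c * k + suc N) * (p₀ + suc N) ^ a      ∎
    where
    open ≤-Reasoning
    open +-*-Solver
    k = suc a
    p₀ = r * suc k + c * k
    B = (suc N + p₀) C a
    B≤n^a : B ≤ (p₀ + suc N) ^ a
    B≤n^a = subst (λ t → t C a ≤ (p₀ + suc N) ^ a) (+-comm p₀ (suc N)) (C≤^ (p₀ + suc N) a)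

lemma6 : (m c : ℕ) → 2 ≤ m → 1 ≤ c →
    Σ ℕ λ K → Σ ℕ λ s₀ → 0 < K × 0 < s₀ ×
      ((s : ℕ) → s₀ ≤ s →
        (F : Family (m * s + c)) →
        Shifted F →
        νLess (λ A → A ∈F F) s →
        DeletionGreater F m (s ∸ c) ((m ∸ 1) * c) →
        (2 * c ∸ 1) * ((m * s + c) C (m ∸ 1)) ≤ y F (m + 1) + K * s ^ (m ∸ 2))
lemma6 (suc (suc a)) (suc c′) (s≤s (s≤s z≤n)) (s≤s z≤n) = suc K , c , s≤s z≤n , s≤s z≤n , bound
  where
  open SpecialPairs c′
  m = suc (suc a)
  L = N * (c * suc a + suc N)
  K = L * (m + c) ^ a
  bound : (s : ℕ) → c ≤ s → (F : Family (m * s + c)) → Shifted F → νLess (_∈F F) s →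
    DeletionGreater F m (s ∸ c) (suc a * c) → (2 * c ∸ 1) * ((m * s + c) C suc a) ≤ y F (m + 1) + suc K * s ^ a
  bound s c≤s F shifted ν<s d>kc = begin
    (2 * c ∸ 1) * ((m * s + c) C suc a)     ≡⟨ cong (λ t → (c′ + t) * ((m * s + c) C suc a)) (+-identityʳ c) ⟩
    N * ((m * s + c) C suc a)               ≤⟨ estimate n≡ F shifted (subst (νLess (_∈F F)) s≡r+c ν<s) d>kc ⟩
    y F (suc a + 2) + L * (m * s + c) ^ a   ≡⟨ cong (λ i → y F (suc i) + L * (m * s + c) ^ a) (+-suc a 1) ⟩
    y F (m + 1) + L * (m * s + c) ^ a       ≤⟨ +-monoʳ-≤ (y F (m + 1)) (*-monoʳ-≤ L ([ms+c]^k≤[m+c]^k*s^k m c a (≤-trans (s≤s z≤n) c≤s))) ⟩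
    y F (m + 1) + L * ((m + c) ^ a * s ^ a) ≡⟨ cong (y F (m + 1) +_) (*-assoc L ((m + c) ^ a) (s ^ a)) ⟨
    y F (m + 1) + K * s ^ a                 ≤⟨ +-monoʳ-≤ (y F (m + 1)) (*-monoˡ-≤ (s ^ a) (n≤1+n K)) ⟩
    y F (m + 1) + suc K * s ^ a             ∎
    where
    open ≤-Reasoning
    s≡r+c : s ≡ (s ∸ c) + c
    s≡r+c = sym (m∸n+n≡m c≤s)
    n≡ : m * s + c ≡ ((s ∸ c) * m + c * suc a) + suc N
    n≡ = trans (cong (λ t → m * t + c) s≡r+c) (n≡p+2c a (s ∸ c))
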